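{- For any even integer $k$ and any integer $s$ with $2\leq s\leq k/2$, \[ \frac{\displaystyle\sum_{\substack{m=0\\ m\text{ even}}}^{s}\binom{k/2}{m/2}^2}{\displaystyle\sum_{\substack{m=0\\ m\text{ even}}}^{s}\binom{k}{m}}\leq\frac{4}{\sqrt{\pi}}\sqrt{\frac{k}{s(k-s)}}. \] -}

module Defs where

open import Data.Nat as ℕ using (ℕ; zero; suc; _+_; _*_; _%_; _≡ᵇ_)
open import Data.Bool using (if_then_else_)
open import Data.Integer as ℤ using (+_)
open import Data.Rational as ℚ using (ℚ)

sumEven : (ℕ → ℕ) → ℕ → ℕ
sumEven f zero    = f zero
sumEven f (suc n) = sumEven f n + (if (suc n % 2) ≡ᵇ 0 then f (suc n) else 0)

-- π := 4 · Σ_{i ≥ 0} (-1)^i / (2i+1)  (Leibniz).  Grouping consecutive terms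
-- in pairs gives positive summands 1/(4i+1) - 1/(4i+3), so the partial sums
--   leibniz n = Σ_{i < n} (1/(4i+1) - 1/(4i+3))
-- increase to π/4, and π = sup_n 4 · leibniz n.
leibniz : ℕ → ℚ
leibniz zero    = ℚ.0ℚ
leibniz (suc n) = leibniz n ℚ.+ ((+ 1 ℚ./ suc (4 * n)) ℚ.- (+ 1 ℚ./ suc (suc (suc (4 * n)))))

π·_≤_ : ℚ → ℚ → Set
π· a ≤ b = ∀ n → a ℚ.* ((+ 4 ℚ./ 1) ℚ.* leibniz n) ℚ.≤ b

ℕ→ℚ : ℕ → ℚ
ℕ→ℚ n = + n ℚ./ 1

{-# OPTIONS --safe #-}
-- Write k = 2n and J = ⌊s/2⌋; the two sums are N = Σ_{j≤J} C(n,j)² and D = Σ_{j≤J} C(2n,2j).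
-- The identity C(n,j)² C(2n,n) = C(2n,2j) C(2j,j) C(2n−2j,n−j) writes C(2n,n)·N as Σ_j b_j t_j
-- with b_j = C(2n,2j) increasing and t_j = C(2j,j) C(2n−2j,n−j) decreasing for 2j ≤ n, so by
-- Chebyshev's sum inequality (J+1)·C(2n,n)·N ≤ D·Σ_j t_j ≤ D·(2J+1)·C(2J,J)·C(2m,m), m = n − J.
-- The estimates 16^x/(4x+1) ≤ C(2x,x)² ≤ 16^x/(3x+1) reduce N² s (k − s) ≤ 4 k D² to a
-- polynomial inequality in J and m that holds for all J and m.  Finally π ≤ 4, because every
-- partial sum of the Leibniz series is at most 1.
module Submission where

open import Defs
open import Data.Nat using (ℕ; _*_; _^_; _∸_; _/_; _≤_)
open import Data.Nat.Divisibility using (_∣_)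
open import Data.Nat.Combinatorics using (_C_)

open import Data.Bool.Base using (if_then_else_)
open import Data.Fin.Base using (zero; suc)
open import Data.Integer.Base as ℤ using (+_)
import Data.Integer.Properties as ℤ
open import Data.List.Base using (_∷_; [])
open import Data.Nat.Base using (zero; suc; _+_; _<_; _%_; _≡ᵇ_; _!; NonZero; z≤n; s≤s; s≤s⁻¹)
open import Data.Nat.Combinatorics using (nCk≡n!/k![n-k]!; k![n∸k]!∣n!; [n-k]*[n-k-1]!≡[n-k]!)
import Data.Nat.Coprimality as Coprime
open import Data.Nat.Coprimality using (1-coprimeTo)
open import Data.Nat.Divisibility using (divides)
open import Data.Nat.DivMod
  using (m/n*n≡m; m*n/n≡m; m/n*n≤m; m≡m%n+[m/n]*n; m%n<n; m/n≡1+[m∸n]/n; m*n%n≡0; [m+kn]%n≡m%n;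
         _divMod_; result)
open import Data.Nat.Properties
open import Algebra.Properties.CommutativeSemigroup *-commutativeSemigroup
  using (interchange; xy∙z≈xz∙y; x∙yz≈yx∙z)
open import Data.Nat.Tactic.RingSolver using (solve-∀; solve)
open import Data.Product using (_,_)
open import Data.Rational.Base as ℚ using (mkℚ; 0ℚ; 1ℚ; *≤*)
import Data.Rational.Properties as ℚ
import Algebra.Properties.Group ℚ.+-0-group as ℚ-+-Group
open import Data.Sum using (inj₁; inj₂)
open import Function using (_∘_; flip)
open import Relation.Binary.Definitions using (Reflexive; Transitive)
open import Relation.Binary.PropositionalEquality

m*2≡m+m : ∀ m → m * 2 ≡ m + m
m*2≡m+m = solve-∀

m^2≡m*m : ∀ m → m ^ 2 ≡ m * m
m^2≡m*m m = cong (m *_) (*-identityʳ m)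

m+k≡n⇒m≤n : ∀ {m n} k → m + k ≡ n → m ≤ n
m+k≡n⇒m≤n k refl = m≤m+n _ k

module _ {_∼_ : ℕ → ℕ → Set} (∼-refl : Reflexive _∼_) (∼-trans : Transitive _∼_)
         (f : ℕ → ℕ) where

  stepwise⇒monotone : ∀ J → (∀ {j} → suc j ≤ J → f j ∼ f (suc j)) →
                      ∀ {i j} → i ≤ j → j ≤ J → f i ∼ f j
  stepwise⇒monotone J step {j = zero}  z≤n   _     = ∼-refl
  stepwise⇒monotone J step {j = suc j} i≤1+j 1+j≤J with m≤n⇒m<n∨m≡n i≤1+j
  ... | inj₂ refl  = ∼-refl
  ... | inj₁ i<1+j =
    ∼-trans (stepwise⇒monotone J step (s≤s⁻¹ i<1+j) (≤-trans (n≤1+n j) 1+j≤J)) (step 1+j≤J)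

-- Binomial coefficients

nCk*[k!*[n∸k]!]≡n! : ∀ {n k} → k ≤ n → (n C k) * (k ! * (n ∸ k) !) ≡ n !
nCk*[k!*[n∸k]!]≡n! {n} {k} k≤n = begin
  (n C k) * (k ! * (n ∸ k) !)                  ≡⟨ cong (_* (k ! * (n ∸ k) !)) (nCk≡n!/k![n-k]! k≤n) ⟩
  n ! / (k ! * (n ∸ k) !) * (k ! * (n ∸ k) !)  ≡⟨ m/n*n≡m (k![n∸k]!∣n! k≤n) ⟩
  n !                                          ∎
  where
  open ≡-Reasoning
  instance _ = k !* (n ∸ k) !≢0

[m+n]Cm*[m!*n!]≡[m+n]! : ∀ m n → ((m + n) C m) * (m ! * n !) ≡ (m + n) !
[m+n]Cm*[m!*n!]≡[m+n]! m n =
  subst (λ o → ((m + n) C m) * (m ! * o !) ≡ (m + n) !) (m+n∸m≡n m n) (nCk*[k!*[n∸k]!]≡n! (m≤m+n m n))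

nC[1+k]*[1+k]≡nCk*[n∸k] : ∀ {n k} → k < n → (n C suc k) * suc k ≡ (n C k) * (n ∸ k)
nC[1+k]*[1+k]≡nCk*[n∸k] {n} {k} k<n = *-cancelʳ-≡ _ _ (k ! * r !) {{k !* r !≢0}} (begin
  (n C suc k) * suc k * (k ! * r !)  ≡⟨ x*y*[z*w]≡x*[y*z*w] (n C suc k) (suc k) (k !) (r !) ⟩
  (n C suc k) * (suc k ! * r !)      ≡⟨ nCk*[k!*[n∸k]!]≡n! k<n ⟩
  n !                                ≡⟨ nCk*[k!*[n∸k]!]≡n! (<⇒≤ k<n) ⟨
  (n C k) * (k ! * (n ∸ k) !)        ≡⟨ cong (λ x → (n C k) * (k ! * x)) ([n-k]*[n-k-1]!≡[n-k]! k<n) ⟨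
  (n C k) * (k ! * ((n ∸ k) * r !))  ≡⟨ x*[y*[z*w]]≡x*z*[y*w] (n C k) (k !) (n ∸ k) (r !) ⟩
  (n C k) * (n ∸ k) * (k ! * r !)    ∎)
  where
  open ≡-Reasoning
  r = n ∸ suc k
  x*y*[z*w]≡x*[y*z*w] : ∀ x y z w → x * y * (z * w) ≡ x * (y * z * w)
  x*y*[z*w]≡x*[y*z*w] = solve-∀
  x*[y*[z*w]]≡x*z*[y*w] : ∀ x y z w → x * (y * (z * w)) ≡ x * z * (y * w)
  x*[y*[z*w]]≡x*z*[y*w] = solve-∀

nCk≤nC[1+k] : ∀ {n k} → k + k < n → n C k ≤ n C suc k
nCk≤nC[1+k] {n} {k} 2k<n = *-cancelʳ-≤ _ _ (suc k) (begin
  (n C k) * suc k      ≤⟨ *-monoʳ-≤ (n C k) (m+n≤o⇒m≤o∸n (suc k) 2k<n) ⟩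
  (n C k) * (n ∸ k)    ≡⟨ nC[1+k]*[1+k]≡nCk*[n∸k] (≤-trans (s≤s (m≤m+n k k)) 2k<n) ⟨
  (n C suc k) * suc k  ∎)
  where open ≤-Reasoning

nCi≤nCj : ∀ n {i j} → i ≤ j → j + j ≤ n → n C i ≤ n C j
nCi≤nCj n {j = j} i≤j 2j≤n = stepwise⇒monotone {_≤_} ≤-refl ≤-trans (n C_) j step i≤j ≤-refl
  where
  step : ∀ {k} → suc k ≤ j → n C k ≤ n C suc k
  step k<j = nCk≤nC[1+k] (<-≤-trans (+-mono-< k<j k<j) 2j≤n)

-- Central binomial coefficients

centralBinom : ℕ → ℕ
centralBinom n = (n + n) C n

centralBinom≢0 : ∀ n → NonZero (centralBinom n)
centralBinom≢0 n =
  m*n≢0⇒m≢0 (centralBinom n) {{subst NonZero (sym ([m+n]Cm*[m!*n!]≡[m+n]! n n)) ((n + n) !≢0)}}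

centralBinom-suc : ∀ n → centralBinom (suc n) * suc n ≡ centralBinom n * (2 * suc (n + n))
centralBinom-suc n = *-cancelʳ-≡ _ _ (suc n * (n ! * n !)) {{m*n≢0 (suc n) _ {{_}} {{n !* n !≢0}}}} (begin
  e′ * suc n * (suc n * (n ! * n !))
    ≡⟨ x*y*[y*[z*w]]≡x*[y*z*[y*w]] e′ (suc n) (n !) (n !) ⟩
  e′ * (suc n ! * suc n !)
    ≡⟨ [m+n]Cm*[m!*n!]≡[m+n]! (suc n) (suc n) ⟩
  (suc n + suc n) !
    ≡⟨ cong (λ m → suc m !) (+-suc n n) ⟩
  suc (suc (n + n)) * (suc (n + n) * (n + n) !)
    ≡⟨ cong (λ x → suc (suc (n + n)) * (suc (n + n) * x)) ([m+n]Cm*[m!*n!]≡[m+n]! n n) ⟨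
  suc (suc (n + n)) * (suc (n + n) * (e * (n ! * n !)))
    ≡⟨ regroup n e (n ! * n !) ⟩
  e * (2 * suc (n + n)) * (suc n * (n ! * n !))
    ∎)
  where
  open ≡-Reasoning
  e′ = centralBinom (suc n)
  e  = centralBinom n
  x*y*[y*[z*w]]≡x*[y*z*[y*w]] : ∀ x y z w → x * y * (y * (z * w)) ≡ x * (y * z * (y * w))
  x*y*[y*[z*w]]≡x*[y*z*[y*w]] = solve-∀
  regroup : ∀ n e f → suc (suc (n + n)) * (suc (n + n) * (e * f)) ≡ e * (2 * suc (n + n)) * (suc n * f)
  regroup = solve-∀

centralBinom-suc≤centralBinom*4 : ∀ n → centralBinom (suc n) ≤ centralBinom n * 4
centralBinom-suc≤centralBinom*4 n = *-cancelʳ-≤ _ _ (suc n) (begin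
  centralBinom (suc n) * suc n        ≡⟨ centralBinom-suc n ⟩
  centralBinom n * (2 * suc (n + n))  ≤⟨ *-monoʳ-≤ (centralBinom n) (m+k≡n⇒m≤n 2 slack) ⟩
  centralBinom n * (4 * suc n)        ≡⟨ *-assoc (centralBinom n) 4 (suc n) ⟨
  centralBinom n * 4 * suc n          ∎)
  where
  open ≤-Reasoning
  slack : 2 * suc (n + n) + 2 ≡ 4 * suc n
  slack = solve (n ∷ [])

centralBinom²-suc : ∀ n → centralBinom (suc n) * centralBinom (suc n) * (suc n * suc n)
                          ≡ centralBinom n * centralBinom n * (4 * (suc (n + n) * suc (n + n)))
centralBinom²-suc n = begin
  e′ * e′ * (suc n * suc n)                          ≡⟨ interchange e′ (suc n) e′ (suc n) ⟨
  e′ * suc n * (e′ * suc n)                          ≡⟨ cong (λ x → x * x) (centralBinom-suc n) ⟩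
  e * (2 * suc (n + n)) * (e * (2 * suc (n + n)))    ≡⟨ regroup e (suc (n + n)) ⟩
  e * e * (4 * (suc (n + n) * suc (n + n)))          ∎
  where
  open ≡-Reasoning
  e′ = centralBinom (suc n)
  e  = centralBinom n
  regroup : ∀ e t → e * (2 * t) * (e * (2 * t)) ≡ e * e * (4 * (t * t))
  regroup = solve-∀

centralBinom²*[1+3n]≤16^n : ∀ n → centralBinom n * centralBinom n * suc (3 * n) ≤ 16 ^ n
centralBinom²*[1+3n]≤16^n zero    = ≤-refl
centralBinom²*[1+3n]≤16^n (suc n) = *-cancelʳ-≤ _ _ (suc n * suc n) (begin
  e′ * e′ * suc (3 * suc n) * (suc n * suc n)     ≡⟨ xy∙z≈xz∙y (e′ * e′) _ _ ⟩
  e′ * e′ * (suc n * suc n) * suc (3 * suc n)     ≡⟨ cong (_* suc (3 * suc n)) (centralBinom²-suc n) ⟩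
  e * e * (4 * (t * t)) * suc (3 * suc n)         ≡⟨ *-assoc (e * e) _ _ ⟩
  e * e * (4 * (t * t) * suc (3 * suc n))         ≤⟨ *-monoʳ-≤ (e * e) (m+k≡n⇒m≤n (4 * n) slack) ⟩
  e * e * (suc (3 * n) * (16 * (suc n * suc n)))  ≡⟨ *-assoc (e * e) _ _ ⟨
  e * e * suc (3 * n) * (16 * (suc n * suc n))    ≤⟨ *-monoˡ-≤ _ (centralBinom²*[1+3n]≤16^n n) ⟩
  16 ^ n * (16 * (suc n * suc n))                 ≡⟨ x∙yz≈yx∙z (16 ^ n) 16 _ ⟩
  16 ^ suc n * (suc n * suc n)                    ∎)
  where
  open ≤-Reasoning
  e′ = centralBinom (suc n)
  e  = centralBinom n
  t  = suc (n + n)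
  slack : 4 * (suc (n + n) * suc (n + n)) * suc (3 * suc n) + 4 * n ≡ suc (3 * n) * (16 * (suc n * suc n))
  slack = solve (n ∷ [])

16^n≤centralBinom²*[1+4n] : ∀ n → 16 ^ n ≤ centralBinom n * centralBinom n * suc (4 * n)
16^n≤centralBinom²*[1+4n] zero    = ≤-refl
16^n≤centralBinom²*[1+4n] (suc n) = *-cancelʳ-≤ _ _ (suc n * suc n) (begin
  16 ^ suc n * (suc n * suc n)                    ≡⟨ x∙yz≈yx∙z (16 ^ n) 16 _ ⟨
  16 ^ n * (16 * (suc n * suc n))                 ≤⟨ *-monoˡ-≤ _ (16^n≤centralBinom²*[1+4n] n) ⟩
  e * e * suc (4 * n) * (16 * (suc n * suc n))    ≡⟨ *-assoc (e * e) _ _ ⟩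
  e * e * (suc (4 * n) * (16 * (suc n * suc n)))  ≤⟨ *-monoʳ-≤ (e * e) (m+k≡n⇒m≤n 4 slack) ⟩
  e * e * (4 * (t * t) * suc (4 * suc n))         ≡⟨ *-assoc (e * e) _ _ ⟨
  e * e * (4 * (t * t)) * suc (4 * suc n)         ≡⟨ cong (_* suc (4 * suc n)) (centralBinom²-suc n) ⟨
  e′ * e′ * (suc n * suc n) * suc (4 * suc n)     ≡⟨ xy∙z≈xz∙y (e′ * e′) _ _ ⟩
  e′ * e′ * suc (4 * suc n) * (suc n * suc n)     ∎)
  where
  open ≤-Reasoning
  e′ = centralBinom (suc n)
  e  = centralBinom n
  t  = suc (n + n)
  slack : suc (4 * n) * (16 * (suc n * suc n)) + 4 ≡ 4 * (suc (n + n) * suc (n + n)) * suc (4 * suc n)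
  slack = solve (n ∷ [])

centralBinom-product²-bound : ∀ j m →
  centralBinom j * centralBinom m * (centralBinom j * centralBinom m) * (suc (3 * j) * suc (3 * m))
    ≤ centralBinom (j + m) * centralBinom (j + m) * suc (4 * (j + m))
centralBinom-product²-bound j m = begin
  e j * e m * (e j * e m) * (suc (3 * j) * suc (3 * m))
    ≡⟨ regroup (e j) (e m) (suc (3 * j)) (suc (3 * m)) ⟩
  e j * e j * suc (3 * j) * (e m * e m * suc (3 * m))
    ≤⟨ *-mono-≤ (centralBinom²*[1+3n]≤16^n j) (centralBinom²*[1+3n]≤16^n m) ⟩
  16 ^ j * 16 ^ m
    ≡⟨ ^-distribˡ-+-* 16 j m ⟨
  16 ^ (j + m)
    ≤⟨ 16^n≤centralBinom²*[1+4n] (j + m) ⟩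
  e (j + m) * e (j + m) * suc (4 * (j + m))
    ∎
  where
  open ≤-Reasoning
  e = centralBinom
  regroup : ∀ x y u v → x * y * (x * y) * (u * v) ≡ x * x * u * (y * y * v)
  regroup = solve-∀

centralBinom-suc*centralBinom≤ : ∀ {j m} → j ≤ m →
  centralBinom (suc j) * centralBinom m ≤ centralBinom j * centralBinom (suc m)
centralBinom-suc*centralBinom≤ {j} {m} j≤m with m≤n⇒∃[o]m+o≡n j≤m
... | d , refl = *-cancelʳ-≤ _ _ (suc j * suc m) (begin
  e (suc j) * e m * (suc j * suc m)        ≡⟨ interchange (e (suc j)) (e m) (suc j) (suc m) ⟩
  e (suc j) * suc j * (e m * suc m)        ≡⟨ cong (_* (e m * suc m)) (centralBinom-suc j) ⟩
  e j * (2 * suc (j + j)) * (e m * suc m)  ≡⟨ interchange (e j) (2 * suc (j + j)) (e m) (suc m) ⟩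
  e j * e m * (2 * suc (j + j) * suc m)    ≤⟨ *-monoʳ-≤ (e j * e m) (m+k≡n⇒m≤n (2 * d) slack) ⟩
  e j * e m * (suc j * (2 * suc (m + m)))  ≡⟨ interchange (e j) (e m) (suc j) (2 * suc (m + m)) ⟩
  e j * suc j * (e m * (2 * suc (m + m)))  ≡⟨ cong (e j * suc j *_) (centralBinom-suc m) ⟨
  e j * suc j * (e (suc m) * suc m)        ≡⟨ interchange (e j) (suc j) (e (suc m)) (suc m) ⟩
  e j * e (suc m) * (suc j * suc m)        ∎)
  where
  open ≤-Reasoning
  e = centralBinom
  slack : 2 * suc (j + j) * suc (j + d) + 2 * d ≡ suc j * (2 * suc (j + d + (j + d)))
  slack = solve (j ∷ d ∷ [])

binomial²-centralBinom-identity : ∀ j m →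
  ((j + m) C j) * ((j + m) C j) * centralBinom (j + m) ≡ (((j + m) * 2) C (j * 2)) * (centralBinom j * centralBinom m)
binomial²-centralBinom-identity j m = *-cancelʳ-≡ _ _ (Q * Q) {{m*n≢0 Q Q {{j !* m !≢0}} {{j !* m !≢0}}}} (begin
  A * A * e (j + m) * (Q * Q)
    ≡⟨ x*x*y*[z*z]≡y*[x*z*[x*z]] A (e (j + m)) Q ⟩
  e (j + m) * (A * Q * (A * Q))
    ≡⟨ cong (λ x → e (j + m) * (x * x)) ([m+n]Cm*[m!*n!]≡[m+n]! j m) ⟩
  e (j + m) * ((j + m) ! * (j + m) !)
    ≡⟨ [m+n]Cm*[m!*n!]≡[m+n]! (j + m) (j + m) ⟩
  (j + m + (j + m)) !
    ≡⟨ cong _! (x+y+[x+y]≡x*2+y*2 j m) ⟩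
  (j * 2 + m * 2) !
    ≡⟨ [m+n]Cm*[m!*n!]≡[m+n]! (j * 2) (m * 2) ⟨
  B′ * ((j * 2) ! * (m * 2) !)
    ≡⟨ cong₂ (λ x y → B′ * (x ! * y !)) (m*2≡m+m j) (m*2≡m+m m) ⟩
  B′ * ((j + j) ! * (m + m) !)
    ≡⟨ cong₂ (λ x y → B′ * (x * y)) ([m+n]Cm*[m!*n!]≡[m+n]! j j) ([m+n]Cm*[m!*n!]≡[m+n]! m m) ⟨
  B′ * (e j * (j ! * j !) * (e m * (m ! * m !)))
    ≡⟨ regroup B′ (e j) (e m) (j !) (m !) ⟩
  B′ * (e j * e m) * (Q * Q)
    ≡⟨ cong (λ x → (x C (j * 2)) * (e j * e m) * (Q * Q)) (*-distribʳ-+ 2 j m) ⟨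
  B * (e j * e m) * (Q * Q)
    ∎)
  where
  open ≡-Reasoning
  e  = centralBinom
  A  = (j + m) C j
  B  = ((j + m) * 2) C (j * 2)
  B′ = (j * 2 + m * 2) C (j * 2)
  Q  = j ! * m !
  x+y+[x+y]≡x*2+y*2 : ∀ x y → x + y + (x + y) ≡ x * 2 + y * 2
  x+y+[x+y]≡x*2+y*2 = solve-∀
  x*x*y*[z*z]≡y*[x*z*[x*z]] : ∀ x y z → x * x * y * (z * z) ≡ y * (x * z * (x * z))
  x*x*y*[z*z]≡y*[x*z*[x*z]] = solve-∀
  regroup : ∀ b x y u v → b * (x * (u * u) * (y * (v * v))) ≡ b * (x * y) * (u * v * (u * v))
  regroup = solve-∀

binomial²-centralBinom-identity′ : ∀ {n j} → j ≤ n →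
  (n C j) * (n C j) * centralBinom n ≡ ((n * 2) C (j * 2)) * (centralBinom j * centralBinom (n ∸ j))
binomial²-centralBinom-identity′ {n} {j} j≤n =
  subst (λ x → (x C j) * (x C j) * centralBinom x ≡ ((x * 2) C (j * 2)) * (centralBinom j * centralBinom (n ∸ j)))
        (m+[n∸m]≡n j≤n) (binomial²-centralBinom-identity j (n ∸ j))

-- Chebyshev's sum inequality

sumUpTo : (ℕ → ℕ) → ℕ → ℕ
sumUpTo f zero    = f zero
sumUpTo f (suc J) = sumUpTo f J + f (suc J)

sumUpTo-cong : ∀ {f g} J → (∀ {j} → j ≤ J → f j ≡ g j) → sumUpTo f J ≡ sumUpTo g J
sumUpTo-cong zero    f≗g = f≗g z≤n
sumUpTo-cong (suc J) f≗g = cong₂ _+_ (sumUpTo-cong J (f≗g ∘ m≤n⇒m≤1+n)) (f≗g ≤-refl)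

sumUpTo-*ʳ : ∀ f c J → sumUpTo (λ j → f j * c) J ≡ sumUpTo f J * c
sumUpTo-*ʳ f c zero    = refl
sumUpTo-*ʳ f c (suc J) =
  trans (cong (_+ f (suc J) * c) (sumUpTo-*ʳ f c J)) (sym (*-distribʳ-+ c (sumUpTo f J) (f (suc J))))

rearrangement : ∀ {a A b B} → a ≤ A → b ≤ B → a * B + A * b ≤ a * b + A * B
rearrangement {a} {b = b} a≤A b≤B with m≤n⇒∃[o]m+o≡n a≤A | m≤n⇒∃[o]m+o≡n b≤B
... | x , refl | y , refl = m+k≡n⇒m≤n (x * y) (solve (a ∷ b ∷ x ∷ y ∷ []))

chebyshev-step : ∀ {f g F G} K → (∀ {j} → j ≤ K → f j ≤ F) → (∀ {j} → j ≤ K → G ≤ g j) →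
  sumUpTo (λ j → f j * g j) K + suc K * (F * G) ≤ sumUpTo f K * G + F * sumUpTo g K
chebyshev-step {f} {g} {F} {G} zero f≤F G≤g =
  subst (λ x → f 0 * g 0 + x ≤ f 0 * G + F * g 0) (sym (+-identityʳ (F * G)))
        (rearrangement (f≤F z≤n) (G≤g z≤n))
chebyshev-step {f} {g} {F} {G} (suc K) f≤F G≤g = begin
  A + f′ * g′ + suc (suc K) * (F * G)                    ≡⟨ regroup A (f′ * g′) K (F * G) ⟩
  A + suc K * (F * G) + (f′ * g′ + F * G)                ≤⟨ +-mono-≤ earlier last ⟩
  sumUpTo f K * G + F * sumUpTo g K + (f′ * G + F * g′)  ≡⟨ regroup′ (sumUpTo f K) f′ (sumUpTo g K) g′ G F ⟩
  (sumUpTo f K + f′) * G + F * (sumUpTo g K + g′)        ∎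
  where
  open ≤-Reasoning
  A  = sumUpTo (λ j → f j * g j) K
  f′ = f (suc K)
  g′ = g (suc K)
  earlier : A + suc K * (F * G) ≤ sumUpTo f K * G + F * sumUpTo g K
  earlier = chebyshev-step K (f≤F ∘ m≤n⇒m≤1+n) (G≤g ∘ m≤n⇒m≤1+n)
  last : f′ * g′ + F * G ≤ f′ * G + F * g′
  last = rearrangement (f≤F ≤-refl) (G≤g ≤-refl)
  regroup : ∀ a p k q → a + p + suc (suc k) * q ≡ a + suc k * q + (p + q)
  regroup = solve-∀
  regroup′ : ∀ a b c d x y → a * x + y * c + (b * x + y * d) ≡ (a + b) * x + y * (c + d)
  regroup′ = solve-∀

chebyshev : ∀ {f g} J →
  (∀ {i j} → i ≤ j → j ≤ J → f i ≤ f j) → (∀ {i j} → i ≤ j → j ≤ J → g j ≤ g i) →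
  suc J * sumUpTo (λ j → f j * g j) J ≤ sumUpTo f J * sumUpTo g J
chebyshev zero _ _ = ≤-reflexive (+-identityʳ _)
chebyshev {f} {g} (suc J) f↑ g↓ = begin
  suc (suc J) * (A + F * G)
    ≡⟨ regroup A (F * G) J ⟩
  suc J * A + (A + suc J * (F * G) + F * G)
    ≤⟨ +-mono-≤ earlier (+-monoˡ-≤ (F * G) last) ⟩
  sumUpTo f J * sumUpTo g J + (sumUpTo f J * G + F * sumUpTo g J + F * G)
    ≡⟨ regroup′ (sumUpTo f J) (sumUpTo g J) F G ⟩
  (sumUpTo f J + F) * (sumUpTo g J + G)
    ∎
  where
  open ≤-Reasoning
  A = sumUpTo (λ j → f j * g j) J
  F = f (suc J)
  G = g (suc J)
  earlier : suc J * A ≤ sumUpTo f J * sumUpTo g J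
  earlier = chebyshev J (λ i≤j → f↑ i≤j ∘ m≤n⇒m≤1+n) (λ i≤j → g↓ i≤j ∘ m≤n⇒m≤1+n)
  last : A + suc J * (F * G) ≤ sumUpTo f J * G + F * sumUpTo g J
  last = chebyshev-step J (λ j≤J → f↑ (m≤n⇒m≤1+n j≤J) ≤-refl)
                          (λ j≤J → g↓ (m≤n⇒m≤1+n j≤J) ≤-refl)
  regroup : ∀ a p k → suc (suc k) * (a + p) ≡ suc k * a + (a + suc k * p + p)
  regroup = solve-∀
  regroup′ : ∀ a b x y → a * b + (a * y + x * b + x * y) ≡ (a + x) * (b + y)
  regroup′ = solve-∀

-- The estimate for k = 2n

sumUpTo-centralBinom-products≤ : ∀ {n} J → J ≤ n →
  sumUpTo (λ j → centralBinom j * centralBinom (n ∸ j)) J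
    ≤ suc (J + J) * (centralBinom J * centralBinom (n ∸ J))
sumUpTo-centralBinom-products≤ zero _ = ≤-reflexive (sym (*-identityˡ _))
sumUpTo-centralBinom-products≤ {n} (suc J) 1+J≤n = begin
  sumUpTo T J + e (suc J) * e m
    ≤⟨ +-monoˡ-≤ _ (sumUpTo-centralBinom-products≤ J (≤-trans (n≤1+n J) 1+J≤n)) ⟩
  suc (J + J) * (e J * e (n ∸ J)) + e (suc J) * e m
    ≡⟨ cong (λ x → suc (J + J) * (e J * e x) + e (suc J) * e m) (+-∸-assoc 1 1+J≤n) ⟩
  suc (J + J) * (e J * e (suc m)) + e (suc J) * e m
    ≤⟨ +-monoˡ-≤ _ (*-monoʳ-≤ (suc (J + J)) (*-monoʳ-≤ (e J) (centralBinom-suc≤centralBinom*4 m))) ⟩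
  suc (J + J) * (e J * (e m * 4)) + e (suc J) * e m
    ≡⟨ cong (_+ e (suc J) * e m) (regroup (suc (J + J)) (e J) (e m)) ⟩
  e J * (2 * suc (J + J)) * (2 * e m) + e (suc J) * e m
    ≡⟨ cong (λ x → x * (2 * e m) + e (suc J) * e m) (centralBinom-suc J) ⟨
  e (suc J) * suc J * (2 * e m) + e (suc J) * e m
    ≡⟨ regroup′ J (e (suc J)) (e m) ⟩
  suc (suc J + suc J) * (e (suc J) * e m)
    ∎
  where
  open ≤-Reasoning
  e = centralBinom
  T = λ j → e j * e (n ∸ j)
  m = n ∸ suc J
  regroup : ∀ t x y → t * (x * (y * 4)) ≡ x * (2 * t) * (2 * y)
  regroup = solve-∀
  regroup′ : ∀ j x y → x * suc j * (2 * y) + x * y ≡ suc (suc j + suc j) * (x * y)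
  regroup′ = solve-∀

sumUpTo-binomial²-bound : ∀ n J → J * 2 ≤ n →
  suc J * (sumUpTo (λ j → (n C j) * (n C j)) J * centralBinom n)
    ≤ sumUpTo (λ j → (n * 2) C (j * 2)) J * (suc (J + J) * (centralBinom J * centralBinom (n ∸ J)))
sumUpTo-binomial²-bound n J J*2≤n = begin
  suc J * (sumUpTo a J * e n)
    ≡⟨ cong (suc J *_) (sumUpTo-*ʳ a (e n) J) ⟨
  suc J * sumUpTo (λ j → a j * e n) J
    ≡⟨ cong (suc J *_) (sumUpTo-cong J (λ j≤J → binomial²-centralBinom-identity′ (≤-trans j≤J J≤n))) ⟩
  suc J * sumUpTo (λ j → b j * T j) J
    ≤⟨ chebyshev J b↑ T↓ ⟩
  sumUpTo b J * sumUpTo T J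
    ≤⟨ *-monoʳ-≤ (sumUpTo b J) (sumUpTo-centralBinom-products≤ J J≤n) ⟩
  sumUpTo b J * (suc (J + J) * (e J * e (n ∸ J)))
    ∎
  where
  open ≤-Reasoning
  e = centralBinom
  a b T : ℕ → ℕ
  a j = (n C j) * (n C j)
  b j = (n * 2) C (j * 2)
  T j = e j * e (n ∸ j)
  J≤n : J ≤ n
  J≤n = ≤-trans (m≤m*n J 2) J*2≤n
  b↑ : ∀ {i j} → i ≤ j → j ≤ J → b i ≤ b j
  b↑ {j = j} i≤j j≤J = nCi≤nCj (n * 2) (*-monoˡ-≤ 2 i≤j)
    (subst (_≤ n * 2) (m*2≡m+m (j * 2)) (*-monoˡ-≤ 2 (≤-trans (*-monoˡ-≤ 2 j≤J) J*2≤n)))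
  T-step : ∀ {j} → suc j ≤ J → T (suc j) ≤ T j
  T-step {j} 1+j≤J =
    subst (λ x → e (suc j) * e (n ∸ suc j) ≤ e j * e x) (sym (+-∸-assoc 1 (≤-trans 1+j≤J J≤n)))
    (centralBinom-suc*centralBinom≤ (m+n≤o⇒m≤o∸n j (begin
      j + suc j      ≤⟨ +-monoˡ-≤ (suc j) (n≤1+n j) ⟩
      suc j + suc j  ≡⟨ m*2≡m+m (suc j) ⟨
      suc j * 2      ≤⟨ *-monoˡ-≤ 2 1+j≤J ⟩
      J * 2          ≤⟨ J*2≤n ⟩
      n              ∎)))
  T↓ : ∀ {i j} → i ≤ j → j ≤ J → T j ≤ T i
  T↓ = stepwise⇒monotone {flip _≤_} ≤-refl (flip ≤-trans) T J T-step

squares-≤-through : ∀ {a b c d x y u v} .{{_ : NonZero d}} →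
  a * (x * d) ≤ y * (b * c) → c * c * u ≤ d * d * v → a * x * (a * x) * u ≤ b * y * (b * y) * v
squares-≤-through {a} {b} {c} {d} {x} {y} {u} {v} axd≤ybc ccu≤ddv =
  *-cancelʳ-≤ _ _ (d * d) {{m*n≢0 d d}} (begin
  a * x * (a * x) * u * (d * d)    ≡⟨ solve (a ∷ d ∷ x ∷ u ∷ []) ⟩
  a * (x * d) * (a * (x * d)) * u  ≤⟨ *-monoˡ-≤ u (*-mono-≤ axd≤ybc axd≤ybc) ⟩
  y * (b * c) * (y * (b * c)) * u  ≡⟨ solve (b ∷ c ∷ y ∷ u ∷ []) ⟩
  b * y * (b * y) * (c * c * u)    ≤⟨ *-monoʳ-≤ (b * y * (b * y)) ccu≤ddv ⟩
  b * y * (b * y) * (d * d * v)    ≡⟨ solve (b ∷ d ∷ y ∷ v ∷ []) ⟩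
  b * y * (b * y) * v * (d * d)    ∎)
  where open ≤-Reasoning

polynomial-bound : ∀ J m →
  m * 2 * (suc (J + J) * suc (J + J) * suc (J + J)) * suc (4 * (J + m))
    ≤ 8 * (J + m) * (suc J * suc J) * (suc (3 * J) * suc (3 * m))
polynomial-bound J m = m+k≡n⇒m≤n _ expansion
  where
  expansion : m * 2 * (suc (J + J) * suc (J + J) * suc (J + J)) * suc (4 * (J + m))
              + (8 * m * m * (J * J * J + 9 * J * J + 9 * J + 2)
                 + 2 * m * (4 * J * J * J * J + 40 * J * J * J + 52 * J * J + 22 * J + 3)
                 + 8 * J * (suc J * suc J) * suc (3 * J))
              ≡ 8 * (J + m) * (suc J * suc J) * (suc (3 * J) * suc (3 * m))
  expansion = solve (J ∷ m ∷ [])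

squared-estimate⇒bound : ∀ {N D J m P} →
  suc J * N * (suc J * N) * (suc (3 * J) * suc (3 * m))
    ≤ suc (J + J) * D * (suc (J + J) * D) * suc (4 * (J + m)) →
  P ≤ suc (J + J) * (m * 2) →
  N * N * P ≤ 4 * ((J + m) * 2) * (D * D)
squared-estimate⇒bound {N} {D} {J} {m} {P} squares≤ P≤ =
  *-cancelʳ-≤ _ _ (suc J * suc J * (suc (3 * J) * suc (3 * m))) (begin
    N * N * P * (suc J * suc J * (suc (3 * J) * suc (3 * m)))
      ≡⟨ solve (N ∷ P ∷ J ∷ m ∷ []) ⟩
    suc J * N * (suc J * N) * (suc (3 * J) * suc (3 * m)) * P
      ≤⟨ *-monoˡ-≤ P squares≤ ⟩
    suc (J + J) * D * (suc (J + J) * D) * suc (4 * (J + m)) * P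
      ≤⟨ *-monoʳ-≤ (suc (J + J) * D * (suc (J + J) * D) * suc (4 * (J + m))) P≤ ⟩
    suc (J + J) * D * (suc (J + J) * D) * suc (4 * (J + m)) * (suc (J + J) * (m * 2))
      ≡⟨ solve (D ∷ J ∷ m ∷ []) ⟩
    D * D * (m * 2 * (suc (J + J) * suc (J + J) * suc (J + J)) * suc (4 * (J + m)))
      ≤⟨ *-monoʳ-≤ (D * D) (polynomial-bound J m) ⟩
    D * D * (8 * (J + m) * (suc J * suc J) * (suc (3 * J) * suc (3 * m)))
      ≡⟨ solve (D ∷ J ∷ m ∷ []) ⟩
    4 * ((J + m) * 2) * (D * D) * (suc J * suc J * (suc (3 * J) * suc (3 * m)))
      ∎)
  where open ≤-Reasoning

evenSums-bound : ∀ n J s → J * 2 ≤ s → s ≤ suc (J * 2) → s ≤ n →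
  sumUpTo (λ j → (n C j) * (n C j)) J ^ 2 * s * (n * 2 ∸ s)
    ≤ 4 * (n * 2) * sumUpTo (λ j → (n * 2) C (j * 2)) J ^ 2
evenSums-bound n J s J*2≤s s≤1+J*2 s≤n = begin
  N ^ 2 * s * (n * 2 ∸ s)      ≡⟨ trans (cong (λ x → x * s * (n * 2 ∸ s)) (m^2≡m*m N)) (*-assoc (N * N) s _) ⟩
  N * N * P                    ≤⟨ squared-estimate⇒bound {N} {D} {J} {m} squares≤ P≤ ⟩
  4 * ((J + m) * 2) * (D * D)  ≡⟨ cong₂ (λ x y → 4 * (x * 2) * y) J+m≡n (sym (m^2≡m*m D)) ⟩
  4 * (n * 2) * D ^ 2          ∎
  where
  open ≤-Reasoning
  N = sumUpTo (λ j → (n C j) * (n C j)) J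
  D = sumUpTo (λ j → (n * 2) C (j * 2)) J
  P = s * (n * 2 ∸ s)
  e = centralBinom
  m = n ∸ J
  J*2≤n : J * 2 ≤ n
  J*2≤n = ≤-trans J*2≤s s≤n
  J+m≡n : J + m ≡ n
  J+m≡n = m+[n∸m]≡n (≤-trans (m≤m*n J 2) J*2≤n)
  products≤ : e J * e m * (e J * e m) * (suc (3 * J) * suc (3 * m)) ≤ e n * e n * suc (4 * (J + m))
  products≤ = subst (λ x → e J * e m * (e J * e m) * (suc (3 * J) * suc (3 * m)) ≤ e x * e x * suc (4 * (J + m)))
                    J+m≡n (centralBinom-product²-bound J m)
  squares≤ : suc J * N * (suc J * N) * (suc (3 * J) * suc (3 * m))
             ≤ suc (J + J) * D * (suc (J + J) * D) * suc (4 * (J + m))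
  squares≤ = squares-≤-through {suc J} {suc (J + J)} {e J * e m} {e n} {N} {D} {{centralBinom≢0 n}}
               (sumUpTo-binomial²-bound n J J*2≤n) products≤
  P≤ : P ≤ suc (J + J) * (m * 2)
  P≤ = *-mono-≤ (subst (λ x → s ≤ suc x) (m*2≡m+m J) s≤1+J*2)
                (≤-trans (∸-monoʳ-≤ (n * 2) J*2≤s) (≤-reflexive (sym (*-distribʳ-∸ 2 n J))))

-- Sums over even indices

sumEven-odd : ∀ f J → sumEven f (suc (J * 2)) ≡ sumEven f (J * 2)
sumEven-odd f J = begin
  sumEven f (J * 2) + (if suc (J * 2) % 2 ≡ᵇ 0 then f (suc (J * 2)) else 0)
    ≡⟨ cong (λ r → sumEven f (J * 2) + (if r ≡ᵇ 0 then f (suc (J * 2)) else 0)) ([m+kn]%n≡m%n 1 J 2) ⟩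
  sumEven f (J * 2) + 0
    ≡⟨ +-identityʳ _ ⟩
  sumEven f (J * 2)
    ∎
  where open ≡-Reasoning

sumEven-even : ∀ f J → sumEven f (J * 2) ≡ sumUpTo (λ j → f (j * 2)) J
sumEven-even f zero    = refl
sumEven-even f (suc J) = cong₂ _+_ (trans (sumEven-odd f J) (sumEven-even f J))
                                   (cong (λ r → if r ≡ᵇ 0 then f (suc J * 2) else 0) (m*n%n≡0 (suc J) 2))

[1+m*2]/2≡m : ∀ m → suc (m * 2) / 2 ≡ m
[1+m*2]/2≡m zero    = refl
[1+m*2]/2≡m (suc m) = trans (m/n≡1+[m∸n]/n {suc (suc m * 2)} {2} (s≤s (s≤s z≤n))) (cong suc ([1+m*2]/2≡m m))

sumEven≡sumUpTo-halves : ∀ f s → sumEven f s ≡ sumUpTo (λ j → f (j * 2)) (s / 2)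
sumEven≡sumUpTo-halves f s with s divMod 2
... | result J zero       refl = trans (sumEven-even f J) (cong (sumUpTo _) (sym (m*n/n≡m J 2)))
... | result J (suc zero) refl =
  trans (trans (sumEven-odd f J) (sumEven-even f J)) (cong (sumUpTo _) (sym ([1+m*2]/2≡m J)))

m≤1+[m/2]*2 : ∀ m → m ≤ suc (m / 2 * 2)
m≤1+[m/2]*2 m = begin
  m                  ≡⟨ m≡m%n+[m/n]*n m 2 ⟩
  m % 2 + m / 2 * 2  ≤⟨ +-monoˡ-≤ (m / 2 * 2) (s≤s⁻¹ (m%n<n m 2)) ⟩
  suc (m / 2 * 2)    ∎
  where open ≤-Reasoning

-- The Leibniz series

ℕ→ℚ≡mkℚ : ∀ n → ℕ→ℚ n ≡ mkℚ (+ n) 0 (Coprime.sym (1-coprimeTo n))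
ℕ→ℚ≡mkℚ n = ℚ.normalize-coprime (Coprime.sym (1-coprimeTo n))

ℕ→ℚ-mono-≤ : ∀ {m n} → m ≤ n → ℕ→ℚ m ℚ.≤ ℕ→ℚ n
ℕ→ℚ-mono-≤ {m} {n} m≤n =
  subst₂ ℚ._≤_ (sym (ℕ→ℚ≡mkℚ m)) (sym (ℕ→ℚ≡mkℚ n))
    (*≤* (ℤ.*-monoʳ-≤-nonNeg (+ 1) (ℤ.+≤+ m≤n)))

ℕ→ℚ-homo-* : ∀ m n → ℕ→ℚ (m * n) ≡ ℕ→ℚ m ℚ.* ℕ→ℚ n
ℕ→ℚ-homo-* m n =
  trans (cong (ℚ._/ 1) (ℤ.pos-* m n)) (sym (cong₂ ℚ._*_ (ℕ→ℚ≡mkℚ m) (ℕ→ℚ≡mkℚ n)))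

1/suc-antimono-≤ : ∀ {m n} → m ≤ n → + 1 ℚ./ suc n ℚ.≤ + 1 ℚ./ suc m
1/suc-antimono-≤ {m} {n} m≤n =
  subst₂ ℚ._≤_ (sym (ℚ.normalize-coprime (1-coprimeTo (suc n)))) (sym (ℚ.normalize-coprime (1-coprimeTo (suc m))))
    (*≤* (ℤ.*-monoˡ-≤-nonNeg (+ 1) (ℤ.+≤+ (s≤s m≤n))))

leibniz+1/[1+4n]≤1 : ∀ n → leibniz n ℚ.+ + 1 ℚ./ suc (4 * n) ℚ.≤ 1ℚ
leibniz+1/[1+4n]≤1 zero    = ℚ.≤-refl
leibniz+1/[1+4n]≤1 (suc n) = begin
  leibniz (suc n) ℚ.+ + 1 ℚ./ suc (4 * suc n)  ≤⟨ ℚ.+-monoʳ-≤ (leibniz (suc n)) (1/suc-antimono-≤ 4n+2≤4[n+1]) ⟩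
  leibniz n ℚ.+ (x ℚ.- y) ℚ.+ y                ≡⟨ ℚ.+-assoc (leibniz n) (x ℚ.- y) y ⟩
  leibniz n ℚ.+ (x ℚ.- y ℚ.+ y)                ≡⟨ cong (leibniz n ℚ.+_) (ℚ-+-Group.//-rightDividesˡ y x) ⟩
  leibniz n ℚ.+ x                              ≤⟨ leibniz+1/[1+4n]≤1 n ⟩
  1ℚ                                           ∎
  where
  open ℚ.≤-Reasoning
  x = + 1 ℚ./ suc (4 * n)
  y = + 1 ℚ./ suc (suc (suc (4 * n)))
  4n+2≤4[n+1] : suc (suc (4 * n)) ≤ 4 * suc n
  4n+2≤4[n+1] = m+k≡n⇒m≤n 2 (solve (n ∷ []))

leibniz≤1 : ∀ n → leibniz n ℚ.≤ 1ℚ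
leibniz≤1 n = begin
  leibniz n                          ≡⟨ ℚ.+-identityʳ (leibniz n) ⟨
  leibniz n ℚ.+ 0ℚ                   ≤⟨ ℚ.+-monoʳ-≤ (leibniz n)
                                          (ℚ.nonNegative⁻¹ _ {{ℚ.normalize-nonNeg 1 (suc (4 * n))}}) ⟩
  leibniz n ℚ.+ + 1 ℚ./ suc (4 * n)  ≤⟨ leibniz+1/[1+4n]≤1 n ⟩
  1ℚ                                 ∎
  where open ℚ.≤-Reasoning

4*a≤b⇒π·a≤b : ∀ a b → 4 * a ≤ b → π· ℕ→ℚ a ≤ ℕ→ℚ b
4*a≤b⇒π·a≤b a b 4a≤b n = begin
  ℕ→ℚ a ℚ.* (ℕ→ℚ 4 ℚ.* leibniz n)  ≤⟨ ℚ.*-monoˡ-≤-nonNeg (ℕ→ℚ a) {{ℚ.normalize-nonNeg a 1}}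
                                         (ℚ.*-monoˡ-≤-nonNeg (ℕ→ℚ 4) (leibniz≤1 n)) ⟩
  ℕ→ℚ a ℚ.* (ℕ→ℚ 4 ℚ.* 1ℚ)         ≡⟨ cong (ℕ→ℚ a ℚ.*_) (ℚ.*-identityʳ (ℕ→ℚ 4)) ⟩
  ℕ→ℚ a ℚ.* ℕ→ℚ 4                  ≡⟨ ℕ→ℚ-homo-* a 4 ⟨
  ℕ→ℚ (a * 4)                      ≤⟨ ℕ→ℚ-mono-≤ (subst (_≤ b) (*-comm 4 a) 4a≤b) ⟩
  ℕ→ℚ b                            ∎
  where open ℚ.≤-Reasoning

-- The estimate also holds for s < 2.
lemma3p3 : (k s : ℕ) → 2 ∣ k → 2 ≤ s → s ≤ k / 2 →
    π· ℕ→ℚ (sumEven (λ m → ((k / 2) C (m / 2)) ^ 2) s ^ 2 * s * (k ∸ s))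
      ≤ ℕ→ℚ (16 * k * sumEven (λ m → k C m) s ^ 2)
lemma3p3 k s (divides n refl) _ s≤k/2 =
  4*a≤b⇒π·a≤b (N′ ^ 2 * s * (n * 2 ∸ s)) (16 * (n * 2) * D′ ^ 2) (begin
    4 * (N′ ^ 2 * s * (n * 2 ∸ s))  ≡⟨ cong (λ x → 4 * (x ^ 2 * s * (n * 2 ∸ s))) N′≡N ⟩
    4 * (N ^ 2 * s * (n * 2 ∸ s))   ≤⟨ *-monoʳ-≤ 4 (evenSums-bound n (s / 2) s J*2≤s s≤1+J*2 s≤n) ⟩
    4 * (4 * (n * 2) * D ^ 2)       ≡⟨ cong (λ x → 4 * (4 * (n * 2) * x ^ 2)) D≡D′ ⟩
    4 * (4 * (n * 2) * D′ ^ 2)      ≡⟨ 4*[4*x*y]≡16*x*y (n * 2) (D′ ^ 2) ⟩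
    16 * (n * 2) * D′ ^ 2           ∎)
  where
  open ≤-Reasoning
  N′ = sumEven (λ m → (((n * 2) / 2) C (m / 2)) ^ 2) s
  D′ = sumEven (λ m → (n * 2) C m) s
  N  = sumUpTo (λ j → (n C j) * (n C j)) (s / 2)
  D  = sumUpTo (λ j → (n * 2) C (j * 2)) (s / 2)
  J*2≤s : s / 2 * 2 ≤ s
  J*2≤s = m/n*n≤m s 2
  s≤1+J*2 : s ≤ suc (s / 2 * 2)
  s≤1+J*2 = m≤1+[m/2]*2 s
  s≤n : s ≤ n
  s≤n = subst (s ≤_) (m*n/n≡m n 2) s≤k/2
  N′≡N : N′ ≡ N
  N′≡N = trans (sumEven≡sumUpTo-halves _ s) (sumUpTo-cong (s / 2) λ {j} _ →
    trans (cong₂ (λ a b → (a C b) ^ 2) (m*n/n≡m n 2) (m*n/n≡m j 2)) (m^2≡m*m (n C j)))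
  D≡D′ : D ≡ D′
  D≡D′ = sym (sumEven≡sumUpTo-halves _ s)
  4*[4*x*y]≡16*x*y : ∀ x y → 4 * (4 * x * y) ≡ 16 * x * y
  4*[4*x*y]≡16*x*y = solve-∀
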